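{- If $G$ is a connected unicyclic graph, then its subdivision graph $S(G)$ is $\alpha$-excellent.
   Context: All graphs are finite and simple. A graph is $\alpha$-excellent if every vertex is contained in some maximum independent set. The subdivision graph $S(G)$ is obtained from $G$ by subdividing every edge of $G$ exactly once. -}

module Defs where

open import Data.Bool using (Bool; true; false; _∨_; not)
open import Data.Nat using (ℕ; _≤_)
open import Data.Fin using (Fin; _<_; _≟_)
open import Data.Sum using (_⊎_; inj₁; inj₂)
open import Data.Product using (Σ; _×_; _,_; ∃; ∃-syntax)
open import Data.List using (List; []; _∷_; length; _++_; [_])
open import Data.List.Membership.Propositional using (_∈_)
open import Data.List.Relation.Unary.Unique.Propositional using (Unique)
open import Relation.Binary.PropositionalEquality using (_≡_; refl)
open import Relation.Nullary.Decidable using (⌊_⌋)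
open import Function.Bundles using (_⇔_)

record Graph (V : Set) : Set where
  field
    adj    : V → V → Bool
    sym    : ∀ u v → adj u v ≡ adj v u
    irrefl : ∀ v → adj v v ≡ false
open Graph public

module _ {V : Set} (G : Graph V) where

  data Walk : V → V → Set where
    here : ∀ {u} → Walk u u
    step : ∀ {u w v} → adj G u w ≡ true → Walk w v → Walk u v

  Connected : Set
  Connected = ∀ u v → Walk u v

  Consec : List V → V → V → Set
  Consec []           u v = Data.Empty.⊥
    where import Data.Empty
  Consec (x ∷ [])     u v = Data.Empty.⊥
    where import Data.Empty
  Consec (x ∷ y ∷ xs) u v = ((x ≡ u) × (y ≡ v)) ⊎ Consec (y ∷ xs) u v

  closeUp : List V → List V
  closeUp []       = []
  closeUp (x ∷ xs) = (x ∷ xs) ++ [ x ]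

  IsCycle : List V → Set
  IsCycle c = (3 ≤ length c) × Unique c
            × (∀ u v → Consec (closeUp c) u v → adj G u v ≡ true)

  CycleEdge : List V → V → V → Set
  CycleEdge c u v = Consec (closeUp c) u v ⊎ Consec (closeUp c) v u

  -- exactly one cycle (cycles identified by their edge sets)
  Unicyclic : Set
  Unicyclic = Σ (List V) λ c → IsCycle c ×
              (∀ d → IsCycle d → ∀ u v → CycleEdge c u v ⇔ CycleEdge d u v)

  Independent : List V → Set
  Independent S = Unique S × (∀ u v → u ∈ S → v ∈ S → adj G u v ≡ false)

  MaximumIndependent : List V → Set
  MaximumIndependent S =
    Independent S × (∀ T → Independent T → length T ≤ length S)

  AlphaExcellent : Set
  AlphaExcellent = ∀ v → Σ (List V) λ S → MaximumIndependent S × v ∈ S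

-- Edges of a graph on Fin n, each unordered edge {i,j} listed once as i < j.
Edge : ∀ {n} → Graph (Fin n) → Set
Edge {n} G = Σ (Fin n × Fin n) λ { (i , j) → (i < j) × (adj G i j ≡ true) }

SVertex : ∀ {n} → Graph (Fin n) → Set
SVertex {n} G = Fin n ⊎ Edge G

private
  incident : ∀ {n} (G : Graph (Fin n)) → Fin n → Edge G → Bool
  incident G v ((i , j) , _) = ⌊ v ≟ i ⌋ ∨ ⌊ v ≟ j ⌋

  sAdj : ∀ {n} (G : Graph (Fin n)) → SVertex G → SVertex G → Bool
  sAdj G (inj₁ v) (inj₁ w) = false
  sAdj G (inj₁ v) (inj₂ e) = incident G v e
  sAdj G (inj₂ e) (inj₁ v) = incident G v e
  sAdj G (inj₂ e) (inj₂ f) = false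

  sSym : ∀ {n} (G : Graph (Fin n)) u v → sAdj G u v ≡ sAdj G v u
  sSym G (inj₁ v) (inj₁ w) = refl
  sSym G (inj₁ v) (inj₂ e) = refl
  sSym G (inj₂ e) (inj₁ v) = refl
  sSym G (inj₂ e) (inj₂ f) = refl

  sIrr : ∀ {n} (G : Graph (Fin n)) v → sAdj G v v ≡ false
  sIrr G (inj₁ v) = refl
  sIrr G (inj₂ e) = refl

S : ∀ {n} (G : Graph (Fin n)) → Graph (SVertex G)
S G = record { adj = sAdj G ; sym = sSym G ; irrefl = sIrr G }

-- Deleting the cycle edge x0x1 of a connected unicyclic graph G leaves a spanning
-- tree. Rooted at x0, it matches every vertex v ≠ x0 with the edge to its parent and
-- x0 with x0x1: a bijection between vertices and edges under which every vertex is an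
-- endpoint of its edge. In S(G) a vertex is adjacent to the subdivision vertex of its
-- edge, so replacing the subdivision vertices of an independent set by their matched
-- vertices is injective, and α(S(G)) ≤ n. The n original vertices and the n
-- subdivision vertices are therefore two maximum independent sets covering S(G).

module Submission where

open import Axiom.UniquenessOfIdentityProofs using (module Decidable⇒UIP)
open import Data.Bool using (true; false; _∨_)
import Data.Bool as Bool
open import Data.Bool.Properties using (∨-zeroʳ)
open import Data.Empty using (⊥; ⊥-elim)
open import Data.Fin using (Fin; _≟_)
import Data.Fin as Fin
open import Data.Fin.Properties using (any?; injective⇒≤)
  renaming (<-cmp to <ᶠ-cmp; <-asym to <ᶠ-asym; <-irrelevant to <ᶠ-irrelevant)
open import Data.List using (List; []; _∷_; _++_; [_]; length; map; lookup; allFin)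
open import Data.List.Properties using (length-map; length-tabulate)
open import Data.List.Membership.Propositional using (_∈_)
open import Data.List.Membership.Propositional.Properties using (∈-map⁺; ∈-map⁻; ∈-lookup; ∈-allFin)
open import Data.List.Relation.Unary.Any using (here; there)
open import Data.List.Relation.Unary.All as All using ([]; _∷_)
open import Data.List.Relation.Unary.All.Properties using (¬Any⇒All¬)
open import Data.List.Relation.Unary.AllPairs using ([]; _∷_)
open import Data.List.Relation.Unary.Unique.Propositional using (Unique)
import Data.List.Relation.Unary.Unique.Propositional.Properties as Unique
open import Data.Nat using (ℕ; zero; suc; _≤_; _<_; _≤?_; z≤n; s≤s)
open import Data.Nat.Properties
  using (≮⇒≥; ≰⇒>; m<1+n⇒m<n∨m≡n; n<1+n; n≤0⇒n≡0; <⇒≤; <⇒≱; <-irrefl; <-asym;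
         ≤-trans; <-≤-trans; ≤-refl; ≤-reflexive; ≤-pred)
open import Data.Product using (Σ; ∃-syntax; _×_; _,_; proj₁; proj₂; swap)
import Data.Product.Properties as Product
open import Data.Sum using (_⊎_; inj₁; inj₂; [_,_]′)
open import Data.Sum.Properties using (inj₁-injective; inj₂-injective)
open import Function using (_∘_)
open import Function.Bundles using (Equivalence; _⇔_)
open import Function.Definitions using (Injective; StrictlySurjective)
open import Level using (0ℓ)
open import Relation.Binary.Core using (Rel)
open import Relation.Binary.Definitions using (DecidableEquality; tri<; tri≈; tri>)
open import Relation.Binary.Construct.Closure.ReflexiveTransitive using (Star; ε; _◅_; _◅◅_; reverse)
open import Relation.Binary.PropositionalEquality
  using (_≡_; _≢_; refl; sym; cong; cong₂; trans; subst; module ≡-Reasoning)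
open import Relation.Nullary using (¬_; Dec; yes; no; ¬?)
open import Relation.Nullary.Decidable using (_×-dec_; _⊎-dec_; dec-true; isYes≗does; ⌊_⌋)
open import Defs hiding (sym)

module _ {A : Set} where

  _≡ᵘ_ : Rel (A × A) 0ℓ
  p ≡ᵘ q = p ≡ q ⊎ p ≡ swap q

  ≡ᵘ-swap : ∀ {p q} → swap p ≡ᵘ q → p ≡ᵘ q
  ≡ᵘ-swap (inj₁ eq) = inj₂ (cong swap eq)
  ≡ᵘ-swap (inj₂ eq) = inj₁ (cong swap eq)

  ≡ᵘ-sym : ∀ {p q} → p ≡ᵘ q → q ≡ᵘ p
  ≡ᵘ-sym (inj₁ refl) = inj₁ refl
  ≡ᵘ-sym (inj₂ refl) = inj₂ refl

  ≡ᵘ-trans : ∀ {p q r} → p ≡ᵘ q → q ≡ᵘ r → p ≡ᵘ r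
  ≡ᵘ-trans (inj₁ refl) q≡r         = q≡r
  ≡ᵘ-trans (inj₂ refl) (inj₁ refl) = inj₂ refl
  ≡ᵘ-trans (inj₂ refl) (inj₂ refl) = inj₁ refl

  ≡ᵘ-dec : DecidableEquality A → ∀ p q → Dec (p ≡ᵘ q)
  ≡ᵘ-dec _≟ᵃ_ p q = ≡-dec p q ⊎-dec ≡-dec p (swap q)
    where
    ≡-dec : DecidableEquality (A × A)
    ≡-dec = Product.≡-dec _≟ᵃ_ _≟ᵃ_

  _∖_ : Rel A 0ℓ → A × A → Rel A 0ℓ
  (R ∖ p) u v = R u v × ¬ (u , v) ≡ᵘ p

  ∖-sym : ∀ {R p} → (∀ {u v} → R u v → R v u) → ∀ {u v} → (R ∖ p) u v → (R ∖ p) v u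
  ∖-sym R-sym (r , ¬p) = R-sym r , ¬p ∘ ≡ᵘ-swap

module _ {P : ℕ → Set} (P? : ∀ k → Dec (P k)) where

  least-below : ∀ k → (Σ ℕ λ m → P m × (∀ {j} → P j → m ≤ j)) ⊎ (∀ {j} → j < k → ¬ P j)
  least-below zero = inj₂ λ ()
  least-below (suc k) with least-below k
  ... | inj₁ found = inj₁ found
  ... | inj₂ none with P? k
  ...   | yes pk = inj₁ (k , pk , λ pj → ≮⇒≥ (λ j<k → none j<k pj))
  ...   | no ¬pk = inj₂ λ j<1+k → [ none , (λ { refl → ¬pk }) ]′ (m<1+n⇒m<n∨m≡n j<1+k)

  least-witness : ∀ {k} → P k → Σ ℕ λ m → P m × (∀ {j} → P j → m ≤ j)
  least-witness {k} pk with least-below (suc k)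
  ... | inj₁ found = found
  ... | inj₂ none  = ⊥-elim (none (n<1+n k) pk)

module _ {A : Set} where

  lookup-injective : ∀ {xs : List A} → Unique xs → ∀ {i j} → lookup xs i ≡ lookup xs j → i ≡ j
  lookup-injective (_  ∷ _) {Fin.zero}  {Fin.zero}  _  = refl
  lookup-injective (x∉ ∷ _) {Fin.zero}  {Fin.suc j} eq = ⊥-elim (All.lookup x∉ (∈-lookup j) eq)
  lookup-injective (x∉ ∷ _) {Fin.suc i} {Fin.zero}  eq = ⊥-elim (All.lookup x∉ (∈-lookup i) (sym eq))
  lookup-injective (_  ∷ u) {Fin.suc i} {Fin.suc j} eq = cong Fin.suc (lookup-injective u eq)

  unique-length-≤ : ∀ {n} {xs : List A} (f : A → Fin n) → Unique xs →
    (∀ {x y} → x ∈ xs → y ∈ xs → f x ≡ f y → x ≡ y) → length xs ≤ n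
  unique-length-≤ {xs = xs} f u f-inj =
    injective⇒≤ λ {i} {j} eq → lookup-injective u (f-inj (∈-lookup i) (∈-lookup j) eq)

module _ {V : Set} (G : Graph V) where

  adj-irrefl : ∀ {v} → adj G v v ≡ true → ⊥
  adj-irrefl {v} vv with trans (sym vv) (irrefl G v)
  ... | ()

  consec-source-∈ : ∀ xs z {u v} → Consec G (xs ++ [ z ]) u v → u ∈ xs
  consec-source-∈ (x ∷ [])     z (inj₁ (refl , _)) = here refl
  consec-source-∈ (x ∷ y ∷ ys) z (inj₁ (refl , _)) = here refl
  consec-source-∈ (x ∷ y ∷ ys) z (inj₂ c)          = there (consec-source-∈ (y ∷ ys) z c)

  ¬consec-second-first : ∀ {x y} zs → 3 ≤ length (x ∷ y ∷ zs) → Unique (x ∷ y ∷ zs) →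
                         ¬ Consec G (y ∷ zs ++ [ x ]) y x
  ¬consec-second-first []       (s≤s (s≤s ())) _
  ¬consec-second-first (z ∷ zs) _ ((_ ∷ x≢z ∷ _) ∷ _) (inj₁ (_ , refl)) = x≢z refl
  ¬consec-second-first (z ∷ zs) _ (_ ∷ y∉ ∷ _) (inj₂ yx) =
    All.lookup y∉ (consec-source-∈ (z ∷ zs) _ yx) refl

module _ {V : Set} {R : Rel V 0ℓ} where

  vertices : ∀ {a b} → Star R a b → List V
  vertices {a} ε       = [ a ]
  vertices {a} (_ ◅ w) = a ∷ vertices w

  suffix : ∀ {a b c} (w : Star R a b) → c ∈ vertices w → Star R c b
  suffix ε         (here refl) = ε
  suffix w@(_ ◅ _) (here refl) = w
  suffix (_ ◅ w)   (there c∈w) = suffix w c∈w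

  suffix-unique : ∀ {a b c} (w : Star R a b) (c∈w : c ∈ vertices w) →
                  Unique (vertices w) → Unique (vertices (suffix w c∈w))
  suffix-unique ε       (here refl) u       = u
  suffix-unique (_ ◅ _) (here refl) u       = u
  suffix-unique (_ ◅ w) (there c∈w) (_ ∷ u) = suffix-unique w c∈w u

  length-vertices-≥1 : ∀ {a b} (w : Star R a b) → 1 ≤ length (vertices w)
  length-vertices-≥1 ε       = s≤s z≤n
  length-vertices-≥1 (_ ◅ _) = s≤s z≤n

module _ {V : Set} (G : Graph V) {R : Rel V 0ℓ} where

  CycleThrough : V → V → Set
  CycleThrough b a = Σ (List V) λ c → IsCycle G c ×
    (∀ u v → Consec G (closeUp G c) u v → R u v ⊎ (u ≡ b × v ≡ a))

  consec-vertices-++ : ∀ {a b} (w : Star R a b) z {u v} →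
                       Consec G (vertices w ++ [ z ]) u v → R u v ⊎ (u ≡ b × v ≡ z)
  consec-vertices-++ ε               z (inj₁ (refl , refl)) = inj₂ (refl , refl)
  consec-vertices-++ (r ◅ ε)         z (inj₁ (refl , refl)) = inj₁ r
  consec-vertices-++ (r ◅ ε)         z (inj₂ c)             = consec-vertices-++ ε z c
  consec-vertices-++ (r ◅ w@(_ ◅ _)) z (inj₁ (refl , refl)) = inj₁ r
  consec-vertices-++ (r ◅ w@(_ ◅ _)) z (inj₂ c)             = consec-vertices-++ w z c

  consec⇒star : ∀ x xs z → (∀ u v → Consec G (x ∷ xs ++ [ z ]) u v → R u v) → Star R x z
  consec⇒star x []       z h = h x z (inj₁ (refl , refl)) ◅ ε
  consec⇒star x (y ∷ ys) z h =
    h x y (inj₁ (refl , refl)) ◅ consec⇒star y ys z (λ u v c → h u v (inj₂ c))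

  path-closes-to-cycle : ∀ {a b} → (∀ {u v} → R u v → adj G u v ≡ true) →
    adj G b a ≡ true → ¬ R a b → (p : Star R a b) → Unique (vertices p) → CycleThrough b a
  path-closes-to-cycle R⇒adj ba ¬ab ε _ = ⊥-elim (adj-irrefl G ba)
  path-closes-to-cycle R⇒adj ba ¬ab (r ◅ ε) _ = ⊥-elim (¬ab r)
  path-closes-to-cycle {a} R⇒adj ba ¬ab p@(_ ◅ _ ◅ w) unique =
    vertices p , (s≤s (s≤s (length-vertices-≥1 w)) , unique , adjacent) ,
    λ _ _ → consec-vertices-++ p a
    where
    adjacent : ∀ u v → Consec G (vertices p ++ [ a ]) u v → adj G u v ≡ true
    adjacent u v c with consec-vertices-++ p a c
    ... | inj₁ r            = R⇒adj r
    ... | inj₂ (refl , refl) = ba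

  module _ (_≟ᵛ_ : DecidableEquality V) where
    open import Data.List.Membership.DecPropositional _≟ᵛ_ using (_∈?_)

    erase-loops : ∀ {a b} → Star R a b → Star R a b
    erase-loops ε = ε
    erase-loops {a} (r ◅ w) with a ∈? vertices (erase-loops w)
    ... | yes a∈w = suffix (erase-loops w) a∈w
    ... | no  _   = r ◅ erase-loops w

    erase-loops-unique : ∀ {a b} (w : Star R a b) → Unique (vertices (erase-loops w))
    erase-loops-unique ε = [] ∷ []
    erase-loops-unique {a} (r ◅ w) with a ∈? vertices (erase-loops w)
    ... | yes a∈w = suffix-unique (erase-loops w) a∈w (erase-loops-unique w)
    ... | no  a∉w = ¬Any⇒All¬ _ a∉w ∷ erase-loops-unique w

    cycle-through-edge : ∀ {a b} → (∀ {u v} → R u v → adj G u v ≡ true) →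
      adj G b a ≡ true → ¬ R a b → Star R a b → CycleThrough b a
    cycle-through-edge R⇒adj ba ¬ab w =
      path-closes-to-cycle R⇒adj ba ¬ab (erase-loops w) (erase-loops-unique w)

module RootedTree {n : ℕ} (T : Rel (Fin n) 0ℓ) (T? : ∀ u v → Dec (T u v))
  (T-sym : ∀ {u v} → T u v → T v u) (T-irrefl : ∀ {v} → ¬ T v v)
  (T-acyclic : ∀ {a b} → T a b → ¬ Star (T ∖ (a , b)) a b)
  (root : Fin n) (reaches-root : ∀ v → Star T v root) where

  Reach : ℕ → Fin n → Set
  Reach zero    v = v ≡ root
  Reach (suc k) v = v ≡ root ⊎ ∃[ u ] T v u × Reach k u

  reach? : ∀ k v → Dec (Reach k v)
  reach? zero    v = v ≟ root
  reach? (suc k) v with v ≟ root | any? (λ u → T? v u ×-dec reach? k u)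
  ... | yes v≡r | _       = yes (inj₁ v≡r)
  ... | no  _   | yes far = yes (inj₂ far)
  ... | no  v≢r | no ¬far = no [ v≢r , ¬far ]′

  star⇒reach : ∀ {v} → Star T v root → ∃[ k ] Reach k v
  star⇒reach ε       = 0 , refl
  star⇒reach (t ◅ w) with star⇒reach w
  ... | k , r = suc k , inj₂ (_ , t , r)

  depth-spec : ∀ v → Σ ℕ λ m → Reach m v × (∀ {k} → Reach k v → m ≤ k)
  depth-spec v = least-witness (λ k → reach? k v) (proj₂ (star⇒reach (reaches-root v)))

  depth : Fin n → ℕ
  depth v = proj₁ (depth-spec v)

  reach-depth : ∀ v → Reach (depth v) v
  reach-depth v = proj₁ (proj₂ (depth-spec v))

  depth-≤ : ∀ {k v} → Reach k v → depth v ≤ k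
  depth-≤ {v = v} = proj₂ (proj₂ (depth-spec v))

  depth-root : depth root ≡ 0
  depth-root = n≤0⇒n≡0 (depth-≤ refl)

  depth-root-minimal : ∀ {v} → ¬ depth v < depth root
  depth-root-minimal {v} dv<dr = <⇒≱ dv<dr (subst (_≤ depth v) (sym depth-root) z≤n)

  depth-≤-root⇒root : ∀ {v} → depth v ≤ depth root → v ≡ root
  depth-≤-root⇒root {v} dv≤dr =
    subst (λ k → Reach k v) (n≤0⇒n≡0 (≤-trans dv≤dr (≤-reflexive depth-root))) (reach-depth v)

  parent : ∀ {v} → v ≢ root → ∃[ u ] T v u × depth u < depth v
  parent {v} v≢r = lower (reach-depth v)
    where
    lower : ∀ {k} → Reach k v → ∃[ u ] T v u × depth u < k
    lower {zero}  v≡r               = ⊥-elim (v≢r v≡r)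
    lower {suc k} (inj₁ v≡r)        = ⊥-elim (v≢r v≡r)
    lower {suc k} (inj₂ (u , t , r)) = u , t , s≤s (depth-≤ r)

  Descent : Rel (Fin n) 0ℓ
  Descent u w = T u w × depth w < depth u

  descend : ∀ v → Star Descent v root
  descend v = descend-within (depth v) v ≤-refl
    where
    descend-within : ∀ k u → depth u ≤ k → Star Descent u root
    descend-within k       u du≤k with u ≟ root
    ... | yes refl = ε
    descend-within zero    u du≤0 | no u≢r = ⊥-elim (u≢r (depth-≤-root⇒root (≤-trans du≤0 z≤n)))
    descend-within (suc k) u du≤k | no u≢r with parent u≢r
    ... | w , t , dw<du = (t , dw<du) ◅ descend-within k w (≤-pred (≤-trans dw<du du≤k))

  descent-misses : ∀ {a v s t} → depth s ≤ depth v → s ≢ v →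
                   Star Descent s t → Star (T ∖ (a , v)) s t
  descent-misses _     _   ε = ε
  descent-misses {a} {v} ds≤dv s≢v (_◅_ {j = u} (t , du<ds) w) =
    (t , λ { (inj₁ refl) → u≢v refl ; (inj₂ refl) → s≢v refl }) ◅ descent-misses (<⇒≤ du<dv) u≢v w
    where
    du<dv : depth u < depth v
    du<dv = <-≤-trans du<ds ds≤dv
    u≢v : u ≢ v
    u≢v refl = <-irrefl refl du<dv

  -- Two lower neighbours a ≢ b of v would close the cycle a → root → b → v → a,
  -- since the descents from a and from b never visit v.
  lower-neighbour-unique : ∀ {a b v} → T a v → T b v →
                           depth a ≤ depth v → depth b ≤ depth v → a ≡ b
  lower-neighbour-unique {a} {b} {v} av bv da≤dv db≤dv with a ≟ b
  ... | yes a≡b = a≡b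
  ... | no  a≢b = ⊥-elim (T-acyclic av (a→root ◅◅ (root→b ◅◅ (b→v ◅ ε))))
    where
    a→root : Star (T ∖ (a , v)) a root
    a→root = descent-misses da≤dv (λ { refl → T-irrefl av }) (descend a)
    root→b : Star (T ∖ (a , v)) root b
    root→b = reverse (∖-sym T-sym) (descent-misses db≤dv (λ { refl → T-irrefl bv }) (descend b))
    b→v : (T ∖ (a , v)) b v
    b→v = bv , λ { (inj₁ refl) → a≢b refl ; (inj₂ refl) → T-irrefl bv }

  neighbour-depth-< : ∀ {a v} → T a v → depth a ≤ depth v → depth a < depth v
  neighbour-depth-< {a} {v} av da≤dv with v ≟ root
  ... | yes refl with depth-≤-root⇒root da≤dv
  ...   | refl = ⊥-elim (T-irrefl av)
  neighbour-depth-< {a} {v} av da≤dv | no v≢r with parent v≢r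
  ... | p , vp , dp<dv with lower-neighbour-unique av (T-sym vp) da≤dv (<⇒≤ dp<dv)
  ...   | refl = dp<dv

module _ {n : ℕ} (G : Graph (Fin n)) where

  ends : Edge G → Fin n × Fin n
  ends = proj₁

  edge-between : ∀ {u w} → adj G u w ≡ true → Σ (Edge G) λ e → ends e ≡ᵘ (u , w)
  edge-between {u} {w} uw with <ᶠ-cmp u w
  ... | tri< u<w _ _ = ((u , w) , u<w , uw) , inj₁ refl
  ... | tri≈ _ refl _ = ⊥-elim (adj-irrefl G uw)
  ... | tri> _ _ w<u = ((w , u) , w<u , trans (Graph.sym G w u) uw) , inj₂ refl

  edge-unique : ∀ {e e′ : Edge G} {p} → ends e ≡ᵘ p → ends e′ ≡ᵘ p → e ≡ e′
  edge-unique {e} {e′} e≡p e′≡p with ≡ᵘ-trans e≡p (≡ᵘ-sym e′≡p)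
  edge-unique {_ , i<j , ij} {_ , i<j′ , ij′} _ _ | inj₁ refl =
    cong₂ (λ lt a → (_ , lt , a)) (<ᶠ-irrelevant i<j i<j′) (Decidable⇒UIP.≡-irrelevant Bool._≟_ ij ij′)
  edge-unique {_ , i<j , _} {_ , j<i , _} _ _ | inj₂ refl = ⊥-elim (<ᶠ-asym i<j j<i)

  Endpoint : Fin n → Edge G → Set
  Endpoint v e = v ≡ proj₁ (ends e) ⊎ v ≡ proj₂ (ends e)

  ≡ᵘ⇒endpoint : ∀ {e : Edge G} {u w} → ends e ≡ᵘ (u , w) → Endpoint u e
  ≡ᵘ⇒endpoint (inj₁ refl) = inj₁ refl
  ≡ᵘ⇒endpoint (inj₂ refl) = inj₂ refl

  ⌊≟⌋-refl : ∀ (v : Fin n) → ⌊ v ≟ v ⌋ ≡ true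
  ⌊≟⌋-refl v = trans (isYes≗does (v ≟ v)) (dec-true (v ≟ v) refl)

  endpoint-adjacent : ∀ {v} {e : Edge G} → Endpoint v e → adj (S G) (inj₁ v) (inj₂ e) ≡ true
  endpoint-adjacent {e = (i , j) , _} (inj₁ refl) = cong (_∨ ⌊ i ≟ j ⌋) (⌊≟⌋-refl i)
  endpoint-adjacent {e = (i , j) , _} (inj₂ refl) =
    trans (cong (⌊ j ≟ i ⌋ ∨_) (⌊≟⌋-refl j)) (∨-zeroʳ _)

  independent-length-≤ : (ψ : Edge G → Fin n) → Injective _≡_ _≡_ ψ → (∀ e → Endpoint (ψ e) e) →
                         ∀ I → Independent (S G) I → length I ≤ n
  independent-length-≤ ψ ψ-inj ψ-end I (unique , independent) =
    unique-length-≤ collapse unique collapse-injective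
    where
    collapse : SVertex G → Fin n
    collapse (inj₁ v) = v
    collapse (inj₂ e) = ψ e
    vertex≢edge : ∀ {v e} → inj₁ v ∈ I → inj₂ e ∈ I → v ≢ ψ e
    vertex≢edge {e = e} v∈I e∈I refl
      with trans (sym (endpoint-adjacent {ψ e} {e} (ψ-end e))) (independent _ _ v∈I e∈I)
    ... | ()
    collapse-injective : ∀ {x y} → x ∈ I → y ∈ I → collapse x ≡ collapse y → x ≡ y
    collapse-injective {inj₁ _} {inj₁ _} _   _   eq = cong inj₁ eq
    collapse-injective {inj₂ _} {inj₂ _} _   _   eq = cong inj₂ (ψ-inj eq)
    collapse-injective {inj₁ _} {inj₂ _} x∈I y∈I eq = ⊥-elim (vertex≢edge x∈I y∈I eq)
    collapse-injective {inj₂ _} {inj₁ _} x∈I y∈I eq = ⊥-elim (vertex≢edge y∈I x∈I (sym eq))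

record IncidenceBijection {n : ℕ} (G : Graph (Fin n)) : Set where
  field
    edge-of    : Fin n → Edge G
    injective  : Injective _≡_ _≡_ edge-of
    surjective : StrictlySurjective _≡_ edge-of
    endpoint   : ∀ v → Endpoint G v (edge-of v)

module _ {n : ℕ} {G : Graph (Fin n)} (β : IncidenceBijection G) where
  open IncidenceBijection β

  vertex-of : Edge G → Fin n
  vertex-of e = proj₁ (surjective e)

  edge-of-vertex-of : ∀ e → edge-of (vertex-of e) ≡ e
  edge-of-vertex-of e = proj₂ (surjective e)

  vertex-of-injective : Injective _≡_ _≡_ vertex-of
  vertex-of-injective {e} {e′} eq = begin
    e                       ≡⟨ sym (edge-of-vertex-of e) ⟩
    edge-of (vertex-of e)   ≡⟨ cong edge-of eq ⟩
    edge-of (vertex-of e′)  ≡⟨ edge-of-vertex-of e′ ⟩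
    e′                      ∎
    where open ≡-Reasoning

  vertex-of-endpoint : ∀ e → Endpoint G (vertex-of e) e
  vertex-of-endpoint e =
    subst (Endpoint G (vertex-of e)) (edge-of-vertex-of e) (endpoint (vertex-of e))

  image-maximum : (f : Fin n → SVertex G) → Injective _≡_ _≡_ f →
                  (∀ u v → adj (S G) (f u) (f v) ≡ false) →
                  MaximumIndependent (S G) (map f (allFin n))
  image-maximum f f-inj f-indep = (Unique.map⁺ f-inj (Unique.allFin⁺ n) , independent) ,
    λ J J-indep → subst (length J ≤_) (sym length-image)
                    (independent-length-≤ G vertex-of vertex-of-injective vertex-of-endpoint J J-indep)
    where
    independent : ∀ x y → x ∈ map f (allFin n) → y ∈ map f (allFin n) → adj (S G) x y ≡ false
    independent x y x∈ y∈ with ∈-map⁻ f x∈ | ∈-map⁻ f y∈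
    ... | u , _ , refl | v , _ , refl = f-indep u v
    length-image : length (map f (allFin n)) ≡ n
    length-image = trans (length-map f (allFin n)) (length-tabulate (λ i → i))

  subdivision-α-excellent : AlphaExcellent (S G)
  subdivision-α-excellent (inj₁ v) =
    map inj₁ (allFin n) , image-maximum inj₁ inj₁-injective (λ _ _ → refl) , ∈-map⁺ inj₁ (∈-allFin v)
  subdivision-α-excellent (inj₂ e) =
    map (inj₂ ∘ edge-of) (allFin n) ,
    image-maximum (inj₂ ∘ edge-of) (injective ∘ inj₂-injective) (λ _ _ → refl) ,
    subst (λ e′ → inj₂ e′ ∈ map (inj₂ ∘ edge-of) (allFin n)) (edge-of-vertex-of e)
      (∈-map⁺ (inj₂ ∘ edge-of) (∈-allFin (vertex-of e)))

module Unicyclic {n : ℕ} (G : Graph (Fin n)) {x0 x1 : Fin n} {rest : List (Fin n)}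
  (cycle : IsCycle G (x0 ∷ x1 ∷ rest))
  (only-cycle : ∀ c → IsCycle G c → ∀ u v → CycleEdge G (x0 ∷ x1 ∷ rest) u v ⇔ CycleEdge G c u v)
  where

  Adj : Rel (Fin n) 0ℓ
  Adj u v = adj G u v ≡ true

  Tree : Rel (Fin n) 0ℓ
  Tree = Adj ∖ (x0 , x1)

  tree? : ∀ u v → Dec (Tree u v)
  tree? u v = (adj G u v Bool.≟ true) ×-dec ¬? (≡ᵘ-dec _≟_ (u , v) (x0 , x1))

  tree-sym : ∀ {u v} → Tree u v → Tree v u
  tree-sym = ∖-sym λ {u} {v} uv → trans (Graph.sym G v u) uv

  tree-irrefl : ∀ {v} → ¬ Tree v v
  tree-irrefl (vv , _) = adj-irrefl G vv

  cycle-adjacent : ∀ u v → Consec G (closeUp G (x0 ∷ x1 ∷ rest)) u v → Adj u v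
  cycle-adjacent = proj₂ (proj₂ cycle)

  x1→x0 : Star Tree x1 x0
  x1→x0 = consec⇒star G x1 rest x0 λ u v uv → cycle-adjacent u v (inj₂ uv) , not-x0x1 uv
    where
    not-x0x1 : ∀ {u v} → Consec G (x1 ∷ rest ++ [ x0 ]) u v → ¬ (u , v) ≡ᵘ (x0 , x1)
    not-x0x1 uv (inj₁ refl) with proj₁ (proj₂ cycle)
    ... | x0∉ ∷ _ = All.lookup x0∉ (consec-source-∈ G (x1 ∷ rest) x0 uv) refl
    not-x0x1 uv (inj₂ refl) = ¬consec-second-first G rest (proj₁ cycle) (proj₁ (proj₂ cycle)) uv

  tree-connects : ∀ {u v} → Walk G u v → Star Tree u v
  tree-connects here = ε
  tree-connects (step {u} {w} uw p) with ≡ᵘ-dec _≟_ (u , w) (x0 , x1)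
  ... | no ¬x0x1        = (uw , ¬x0x1) ◅ tree-connects p
  ... | yes (inj₁ refl) = reverse tree-sym x1→x0 ◅◅ tree-connects p
  ... | yes (inj₂ refl) = x1→x0 ◅◅ tree-connects p

  -- A cycle through ab inside the tree would be a cycle of G avoiding x0x1.
  tree-acyclic : ∀ {a b} → Tree a b → ¬ Star (Tree ∖ (a , b)) a b
  tree-acyclic {a} {b} ab w
    with cycle-through-edge G _≟_ (proj₁ ∘ proj₁) (proj₁ (tree-sym ab)) (λ r → proj₂ r (inj₁ refl)) w
  ... | c , c-cycle , c-edges =
    avoids-x0x1 (Equivalence.to (only-cycle c c-cycle x0 x1) (inj₁ (inj₁ (refl , refl))))
    where
    not-on-c : ∀ {u v} → (u , v) ≡ᵘ (x0 , x1) → ¬ Consec G (closeUp G c) u v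
    not-on-c x0x1 uv with c-edges _ _ uv
    ... | inj₁ ((_ , ¬x0x1) , _) = ¬x0x1 x0x1
    ... | inj₂ (refl , refl)     = proj₂ ab (≡ᵘ-swap x0x1)
    avoids-x0x1 : ¬ CycleEdge G c x0 x1
    avoids-x0x1 (inj₁ c01) = not-on-c (inj₁ refl) c01
    avoids-x0x1 (inj₂ c10) = not-on-c (inj₂ refl) c10

  module _ (connected : Connected G) where
    open RootedTree Tree tree? tree-sym tree-irrefl tree-acyclic
                    x0 (λ v → tree-connects (connected v x0))

    data ParentEdge : Fin n → Edge G → Set where
      root-edge : ∀ {e} → ends G e ≡ᵘ (x0 , x1) → ParentEdge x0 e
      to-parent : ∀ {v p e} → Tree v p → depth p < depth v → ends G e ≡ᵘ (v , p) → ParentEdge v e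

    parent-edge : ∀ v → Σ (Edge G) (ParentEdge v)
    parent-edge v with v ≟ x0
    ... | yes refl with edge-between G (cycle-adjacent x0 x1 (inj₁ (refl , refl)))
    ...   | e , e≡ = e , root-edge e≡
    parent-edge v | no v≢x0 with parent v≢x0
    ... | p , vp , dp<dv with edge-between G (proj₁ vp)
    ...   | e , e≡ = e , to-parent vp dp<dv e≡

    parent-edge-injective : ∀ {v w e} → ParentEdge v e → ParentEdge w e → v ≡ w
    parent-edge-injective (root-edge _) (root-edge _) = refl
    parent-edge-injective (root-edge e≡) (to-parent wp _ e≡′) =
      ⊥-elim (proj₂ wp (≡ᵘ-trans (≡ᵘ-sym e≡′) e≡))
    parent-edge-injective (to-parent vp _ e≡) (root-edge e≡′) =
      ⊥-elim (proj₂ vp (≡ᵘ-trans (≡ᵘ-sym e≡) e≡′))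
    parent-edge-injective (to-parent _ dp<dv e≡) (to-parent _ dq<dw e≡′)
      with ≡ᵘ-trans (≡ᵘ-sym e≡) e≡′
    ... | inj₁ refl = refl
    ... | inj₂ refl = ⊥-elim (<-asym dp<dv dq<dw)

    parent-edge-functional : ∀ {v e e′} → ParentEdge v e → ParentEdge v e′ → e ≡ e′
    parent-edge-functional (root-edge e≡) (root-edge e≡′) = edge-unique G e≡ e≡′
    parent-edge-functional (root-edge _) (to-parent _ dp<d0 _) = ⊥-elim (depth-root-minimal dp<d0)
    parent-edge-functional (to-parent _ dp<d0 _) (root-edge _) = ⊥-elim (depth-root-minimal dp<d0)
    parent-edge-functional (to-parent vp dp<dv e≡) (to-parent vq dq<dv e≡′)
      with lower-neighbour-unique (tree-sym vp) (tree-sym vq) (<⇒≤ dp<dv) (<⇒≤ dq<dv)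
    ... | refl = edge-unique G e≡ e≡′

    parent-edge-surjective : ∀ e → ∃[ v ] ParentEdge v e
    parent-edge-surjective ((i , j) , _ , ij) with ≡ᵘ-dec _≟_ (i , j) (x0 , x1)
    ... | yes x0x1 = x0 , root-edge x0x1
    ... | no ¬x0x1 with depth i ≤? depth j
    ...   | yes di≤dj =
      j , to-parent (tree-sym (ij , ¬x0x1)) (neighbour-depth-< (ij , ¬x0x1) di≤dj) (inj₂ refl)
    ...   | no  di≰dj = i , to-parent (ij , ¬x0x1) (≰⇒> di≰dj) (inj₁ refl)

    parent-edge-endpoint : ∀ {v e} → ParentEdge v e → Endpoint G v e
    parent-edge-endpoint {e = e} (root-edge e≡)     = ≡ᵘ⇒endpoint G {e} e≡
    parent-edge-endpoint {e = e} (to-parent _ _ e≡) = ≡ᵘ⇒endpoint G {e} e≡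

    incidence-bijection : IncidenceBijection G
    incidence-bijection = record
      { edge-of    = proj₁ ∘ parent-edge
      ; injective  = λ {v} {w} eq → parent-edge-injective (proj₂ (parent-edge v))
                                      (subst (ParentEdge w) (sym eq) (proj₂ (parent-edge w)))
      ; surjective = λ e → let v , ve = parent-edge-surjective e in
                           v , parent-edge-functional (proj₂ (parent-edge v)) ve
      ; endpoint   = parent-edge-endpoint ∘ proj₂ ∘ parent-edge
      }

corollary3p4 : (n : ℕ) (G : Graph (Fin n)) →
    Connected G → Unicyclic G → AlphaExcellent (S G)
corollary3p4 n G connected ([]          , (() , _) , _)
corollary3p4 n G connected (_ ∷ []      , (s≤s () , _) , _)
corollary3p4 n G connected (_ ∷ _ ∷ _   , cycle , only-cycle) =
  subdivision-α-excellent (Unicyclic.incidence-bijection G cycle only-cycle connected)
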